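{- Let $\mathsf{ILX}$ be any extension of $\mathsf{IL}$, let $w,x,v,z$ be maximal $\mathsf{ILX}$-consistent sets and $S$ a set of formulas. If $w\prec_{x^\Box_S}v$ and $v\prec z$, then $x\prec_S z$.
   Context: Modal formulas are built from propositional variables, $\bot$, $\to$ and binary $\rhd$; $\Box A$ abbreviates $\neg A\rhd\bot$. $\mathsf{IL}$ has as axioms all instances of classical tautologies and of: $\Box(A\to B)\to(\Box A\to\Box B)$; $\Box(\Box A\to A)\to\Box A$; $\Box(A\to B)\to A\rhd B$; $(A\rhd B)\wedge(B\rhd C)\to A\rhd C$; $(A\rhd C)\wedge(B\rhd C)\to A\vee B\rhd C$; $A\rhd B\to(\Diamond A\to\Diamond B)$; $\Diamond A\rhd A$ (with $\Diamond A=\neg\Box\neg A$); rules modus ponens and necessitation. $\mathsf{ILX}$ is $\mathsf{IL}$ extended by additional axiom schemata. For maximal consistent sets $w,u$ and a set of formulas $S$: $w\prec_S u$ iff for every finite $S'\subseteq S$ and every formula $A$, $A\rhd\bigvee_{G\in S'}\neg G\in w$ implies $\neg A\in u$ and $\Box\neg A\in u$ (empty disjunction is $\bot$); $w\prec u$ means $w\prec_\emptyset u$. $x^\Box_S=\{\Box\neg A : A\rhd\bigvee_{G\in S'}\neg G\in x \text{ for some finite } S'\subseteq S\}$. -}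

module Defs where

open import Data.Nat using (ℕ)
open import Data.Bool using (Bool; true; false; not; _∨_)
open import Data.List using (List; []; _∷_; foldr)
open import Data.List.Relation.Unary.All using (All)
open import Data.Product using (Σ; _×_; ∃)
open import Data.Sum using (_⊎_)
open import Relation.Nullary using (¬_)
open import Relation.Binary.PropositionalEquality using (_≡_)

infixr 6 _⇒_
infix 7 _▷_

data Form : Set where
  var : ℕ → Form
  ⊥'  : Form
  _⇒_ : Form → Form → Form
  _▷_ : Form → Form → Form

∼_ : Form → Form
∼ A = A ⇒ ⊥'

⊤' : Form
⊤' = ⊥' ⇒ ⊥'

_∨'_ : Form → Form → Form
A ∨' B = (∼ A) ⇒ B

_∧'_ : Form → Form → Form
A ∧' B = ∼ (A ⇒ ∼ B)

□ : Form → Form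
□ A = (∼ A) ▷ ⊥'

◇ : Form → Form
◇ A = ∼ (□ (∼ A))

-- Classical tautologies: true under every Boolean valuation in which
-- propositional variables and ▷-formulas are treated as atoms.
eval : (Form → Bool) → Form → Bool
eval v (var n) = v (var n)
eval v ⊥' = false
eval v (A ⇒ B) = not (eval v A) ∨ eval v B
eval v (A ▷ B) = v (A ▷ B)

Tautology : Form → Set
Tautology A = (v : Form → Bool) → eval v A ≡ true

data _⊢_ (X : Form → Set) : Form → Set where
  taut : ∀ {A} → Tautology A → X ⊢ A
  axK  : ∀ {A B} → X ⊢ (□ (A ⇒ B) ⇒ (□ A ⇒ □ B))
  axL  : ∀ {A} → X ⊢ (□ (□ A ⇒ A) ⇒ □ A)
  axJ1 : ∀ {A B} → X ⊢ (□ (A ⇒ B) ⇒ A ▷ B)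
  axJ2 : ∀ {A B C} → X ⊢ (((A ▷ B) ∧' (B ▷ C)) ⇒ A ▷ C)
  axJ3 : ∀ {A B C} → X ⊢ (((A ▷ C) ∧' (B ▷ C)) ⇒ (A ∨' B) ▷ C)
  axJ4 : ∀ {A B} → X ⊢ ((A ▷ B) ⇒ (◇ A ⇒ ◇ B))
  axJ5 : ∀ {A} → X ⊢ ((◇ A) ▷ A)
  axX  : ∀ {A} → X A → X ⊢ A
  mp   : ∀ {A B} → X ⊢ (A ⇒ B) → X ⊢ A → X ⊢ B
  nec  : ∀ {A} → X ⊢ A → X ⊢ □ A

FSet : Set₁
FSet = Form → Set

_∈_ : Form → FSet → Set
A ∈ Γ = Γ A

∅ : FSet
∅ _ = Data.Empty.⊥
  where import Data.Empty

_∪｛_｝ : FSet → Form → FSet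
(Γ ∪｛ A ｝) B = Γ B ⊎ B ≡ A

⋀ : List Form → Form
⋀ = foldr _∧'_ ⊤'

Consistent : (X : FSet) → FSet → Set
Consistent X Γ = ¬ (Σ (List Form) λ L → All Γ L × (X ⊢ (⋀ L ⇒ ⊥')))

MCS : (X : FSet) → FSet → Set
MCS X Γ = Consistent X Γ × ((A : Form) → Consistent X (Γ ∪｛ A ｝) → A ∈ Γ)

⋁¬ : List Form → Form
⋁¬ = foldr (λ G acc → (∼ G) ∨' acc) ⊥'

_≺[_]_ : FSet → FSet → FSet → Set
w ≺[ S ] u = (S' : List Form) → All S S' → (A : Form) →
             (A ▷ ⋁¬ S') ∈ w → ((∼ A) ∈ u) × (□ (∼ A) ∈ u)

_≺_ : FSet → FSet → Set
w ≺ u = w ≺[ ∅ ] u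

_^□_ : FSet → FSet → FSet
(x ^□ S) φ = Σ Form λ A → Σ (List Form) λ S' →
             All S S' × ((A ▷ ⋁¬ S') ∈ x) × (φ ≡ □ (∼ A))

module Submission where

-- Let S' ⊆ S be finite with  A ▷ ⋁¬S' ∈ x.  Then □¬A ∈ x^□_S, and the
-- proof rests on two general facts about the relations ≺_T between
-- maximal consistent sets:
--   * w ≺_T v implies T ⊆ v: for D ∈ T the theorem  B ▷ B  with
--     B = ⋁¬[D] = ¬¬D → ⊥ lies in w, so ≺_T puts ¬B, hence D, into v;
--   * v ≺ z and □B ∈ v imply B ∈ z and □B ∈ z: since □B is literally
--     ¬B ▷ ⊥ = ¬B ▷ ⋁¬[], the relation ≺ yields ¬¬B and □¬¬B in z.
-- Applying the first fact to D = □¬A and the second to B = ¬A gives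
-- ¬A ∈ z and □¬A ∈ z, i.e. x ≺_S z.

open import Defs
open import Data.Bool using (true; false)
open import Data.List using (List; []; _∷_; _++_)
open import Data.List.Relation.Unary.All using (All; []; _∷_)
open import Data.List.Relation.Unary.All.Properties using (++⁺)
open import Data.Product using (Σ; _×_; _,_; proj₁; proj₂)
open import Data.Sum using (inj₁; inj₂)
open import Relation.Binary.PropositionalEquality using (refl)

module Propositional {X : FSet} where

  weakening-taut : ∀ {P Q} → Tautology (P ⇒ (Q ⇒ P))
  weakening-taut {P} {Q} v with eval v P | eval v Q
  ... | true  | true  = refl
  ... | true  | false = refl
  ... | false | true  = refl
  ... | false | false = refl

  syllogism-taut : ∀ {P Q R} → Tautology ((P ⇒ Q) ⇒ ((Q ⇒ R) ⇒ (P ⇒ R)))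
  syllogism-taut {P} {Q} {R} v with eval v P | eval v Q | eval v R
  ... | true  | true  | true  = refl
  ... | true  | true  | false = refl
  ... | true  | false | true  = refl
  ... | true  | false | false = refl
  ... | false | true  | true  = refl
  ... | false | true  | false = refl
  ... | false | false | true  = refl
  ... | false | false | false = refl

  pairing-taut : ∀ {P Q R} → Tautology ((P ⇒ Q) ⇒ ((P ⇒ R) ⇒ (P ⇒ (Q ∧' R))))
  pairing-taut {P} {Q} {R} v with eval v P | eval v Q | eval v R
  ... | true  | true  | true  = refl
  ... | true  | true  | false = refl
  ... | true  | false | true  = refl
  ... | true  | false | false = refl
  ... | false | true  | true  = refl
  ... | false | true  | false = refl
  ... | false | false | true  = refl
  ... | false | false | false = refl

  ∧-left-taut : ∀ {P Q} → Tautology ((P ∧' Q) ⇒ P)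
  ∧-left-taut {P} {Q} v with eval v P | eval v Q
  ... | true  | true  = refl
  ... | true  | false = refl
  ... | false | true  = refl
  ... | false | false = refl

  ∧-right-taut : ∀ {P Q} → Tautology ((P ∧' Q) ⇒ Q)
  ∧-right-taut {P} {Q} v with eval v P | eval v Q
  ... | true  | true  = refl
  ... | true  | false = refl
  ... | false | true  = refl
  ... | false | false = refl

  identity-taut : ∀ {P} → Tautology (P ⇒ P)
  identity-taut {P} v with eval v P
  ... | true  = refl
  ... | false = refl

  double-negation-taut : ∀ {P} → Tautology (∼ (∼ P) ⇒ P)
  double-negation-taut {P} v with eval v P
  ... | true  = refl
  ... | false = refl

  weaken : ∀ {P Q} → X ⊢ P → X ⊢ (Q ⇒ P)
  weaken {P} {Q} = mp (taut (weakening-taut {P} {Q}))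

  _⨾_ : ∀ {P Q R} → X ⊢ (P ⇒ Q) → X ⊢ (Q ⇒ R) → X ⊢ (P ⇒ R)
  _⨾_ {P} {Q} {R} d e = mp (mp (taut (syllogism-taut {P} {Q} {R})) d) e
  infixr 5 _⨾_

  ⟨_,_⟩ : ∀ {P Q R} → X ⊢ (P ⇒ Q) → X ⊢ (P ⇒ R) → X ⊢ (P ⇒ (Q ∧' R))
  ⟨_,_⟩ {P} {Q} {R} d e = mp (mp (taut (pairing-taut {P} {Q} {R})) d) e

  ∧-left : ∀ {P Q} → X ⊢ ((P ∧' Q) ⇒ P)
  ∧-left {P} {Q} = taut (∧-left-taut {P} {Q})

  ∧-right : ∀ {P Q} → X ⊢ ((P ∧' Q) ⇒ Q)
  ∧-right {P} {Q} = taut (∧-right-taut {P} {Q})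

  identity : ∀ {P} → X ⊢ (P ⇒ P)
  identity {P} = taut (identity-taut {P})

  ⊤-intro : ∀ {P} → X ⊢ (P ⇒ ⊤')
  ⊤-intro = weaken identity

  double-negation : ∀ {P} → X ⊢ (∼ (∼ P) ⇒ P)
  double-negation {P} = taut (double-negation-taut {P})

  ⋀-++ : ∀ L M → X ⊢ (⋀ (L ++ M) ⇒ (⋀ L ∧' ⋀ M))
  ⋀-++ []      M = ⟨ ⊤-intro , identity ⟩
  ⋀-++ (C ∷ L) M = ⟨ ⟨ ∧-left , ∧-right ⨾ ⋀-++ L M ⨾ ∧-left ⟩
                   , ∧-right ⨾ ⋀-++ L M ⨾ ∧-right ⟩

open Propositional

module MaximalConsistent {X : FSet} {Γ : FSet} (mcs : MCS X Γ) where

  -- A finite subset of Γ ∪ {B} can be replaced by one of Γ, provided B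
  -- follows from some finite L ⊆ Γ: every occurrence of B is traded for L.
  eliminate : ∀ {B L} L' → All (Γ ∪｛ B ｝) L' → X ⊢ (⋀ L ⇒ B) → All Γ L →
              Σ (List Form) λ M → All Γ M × (X ⊢ (⋀ M ⇒ ⋀ L'))
  eliminate [] [] _ _ = [] , [] , identity
  eliminate (C ∷ L') (inj₁ C∈Γ ∷ L'⊆) L⇒B L⊆Γ
    with eliminate L' L'⊆ L⇒B L⊆Γ
  ... | M , M⊆Γ , M⇒L' = C ∷ M , C∈Γ ∷ M⊆Γ , ⟨ ∧-left , ∧-right ⨾ M⇒L' ⟩
  eliminate {L = L} (C ∷ L') (inj₂ refl ∷ L'⊆) L⇒B L⊆Γ
    with eliminate L' L'⊆ L⇒B L⊆Γ
  ... | M , M⊆Γ , M⇒L' =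
    L ++ M , ++⁺ L⊆Γ M⊆Γ ,
    ⟨ ⋀-++ L M ⨾ ∧-left ⨾ L⇒B , ⋀-++ L M ⨾ ∧-right ⨾ M⇒L' ⟩

  -- Γ is closed under derivable consequence of finitely many members:
  -- adding such a B to Γ keeps it consistent, so B ∈ Γ by maximality.
  closed : ∀ {B} L → All Γ L → X ⊢ (⋀ L ⇒ B) → B ∈ Γ
  closed {B} L L⊆Γ L⇒B = maximal B extension-consistent
    where
    consistent : Consistent X Γ
    consistent = proj₁ mcs

    maximal : (A : Form) → Consistent X (Γ ∪｛ A ｝) → A ∈ Γ
    maximal = proj₂ mcs

    extension-consistent : Consistent X (Γ ∪｛ B ｝)
    extension-consistent (L' , L'⊆ , L'⇒⊥) with eliminate L' L'⊆ L⇒B L⊆Γ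
    ... | M , M⊆Γ , M⇒L' = consistent (M , M⊆Γ , M⇒L' ⨾ L'⇒⊥)

  theorem∈ : ∀ {B} → X ⊢ B → B ∈ Γ
  theorem∈ ⊢B = closed [] [] (weaken ⊢B)

  consequence∈ : ∀ {P Q} → P ∈ Γ → X ⊢ (P ⇒ Q) → Q ∈ Γ
  consequence∈ P∈Γ P⇒Q = closed (_ ∷ []) (P∈Γ ∷ []) (∧-left ⨾ P⇒Q)

open MaximalConsistent

module Accessibility {X : FSet} where

  ▷-refl : ∀ {B} → X ⊢ (B ▷ B)
  ▷-refl = mp axJ1 (nec identity)

  -- w ≺_T v forces T ⊆ v.  With B = ⋁¬[D] = ¬¬D → ⊥, the theorem B ▷ B
  -- lies in w, so ¬B ∈ v; and ¬B is ¬¬¬¬D, which implies D.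
  ≺-includes : ∀ {T w v D} → MCS X w → MCS X v → w ≺[ T ] v → D ∈ T → D ∈ v
  ≺-includes {D = D} mw mv w≺v D∈T
    with w≺v (D ∷ []) (D∈T ∷ []) (⋁¬ (D ∷ [])) (theorem∈ mw ▷-refl)
  ... | ¬B∈v , _ = consequence∈ mv ¬B∈v (double-negation ⨾ double-negation)

  -- v ≺ z transfers boxed formulas: □B is by definition ¬B ▷ ⋁¬[], so
  -- ≺ puts ¬¬B and □¬¬B into z, which yield B and (by K) □B.
  ≺-unbox : ∀ {v z B} → MCS X z → v ≺ z → □ B ∈ v → B ∈ z × □ B ∈ z
  ≺-unbox {B = B} mz v≺z □B∈v with v≺z [] [] (∼ B) □B∈v
  ... | ¬¬B∈z , □¬¬B∈z =
    consequence∈ mz ¬¬B∈z double-negation ,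
    consequence∈ mz □¬¬B∈z (mp axK (nec double-negation))

open Accessibility

mainTheorem16 : (X : FSet) (S : FSet) (w x v z : FSet) →
    MCS X w → MCS X x → MCS X v → MCS X z →
    w ≺[ x ^□ S ] v → v ≺ z → x ≺[ S ] z
mainTheorem16 X S w x v z mw _ mv mz w≺v v≺z S' S'⊆S A A▷S'∈x =
  ≺-unbox {v = v} mz v≺z □¬A∈v
  where
  □¬A∈x^□S : □ (∼ A) ∈ (x ^□ S)
  □¬A∈x^□S = A , S' , S'⊆S , A▷S'∈x , refl

  □¬A∈v : □ (∼ A) ∈ v
  □¬A∈v = ≺-includes mw mv w≺v □¬A∈x^□S
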